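{- Let $P=([n],\preceq)$ be a poset and $0\le r,m\le n$. If there is an $r$-error-correcting $P$-code $\mathcal{C}\subseteq F^n$ with $|\mathcal{C}|=2^{n-m}$, then $|I'\cup I''|\le m$ for all $I',I''\in\mathcal{I}_P^r$.
   Context: $[n]=\{1,\dots,n\}$; subsets of $[n]$ are identified with their characteristic vectors in $F^n=\{0,1\}^n$, and $x+y$ is the symmetric difference. An ideal of $P$ is a set $I\subseteq[n]$ such that $a\in I$ and $b\preceq a$ imply $b\in I$; ${<}X{>}$ is the smallest ideal containing $X$. $\mathcal{I}_P^r$ is the set of ideals of cardinality $r$. The $P$-weight is $w_P(x)=|{<}x{>}|$ and $\mathcal{B}_P^r=\{x\in F^n: w_P(x)\le r\}$. A $P$-code $\mathcal{C}\subseteq F^n$ is $r$-error-correcting if every $x\in F^n$ has at most one representation $x=c+b$ with $c\in\mathcal{C}$, $b\in\mathcal{B}_P^r$. -}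

module Defs where

open import Data.Nat using (ℕ; _≤_)
open import Data.Bool using (Bool; _xor_)
open import Data.Fin using (Fin)
open import Data.Fin.Properties using (any?)
open import Data.Fin.Subset using (Subset; _∈_; ∣_∣)
open import Data.Fin.Subset.Properties using (_∈?_)
open import Data.Vec using (zipWith; tabulate)
open import Data.List using (List)
open import Data.List.Membership.Propositional renaming (_∈_ to _∈ₗ_)
open import Data.Product using (_×_)
open import Data.Product.Properties using () 
open import Relation.Nullary using (does)
open import Relation.Nullary.Decidable using (_×-dec_)
open import Relation.Binary.Definitions using (Decidable)
open import Relation.Binary.Structures using (IsDecPartialOrder)
open import Relation.Binary.PropositionalEquality using (_≡_)

_⊕_ : ∀ {n} → Subset n → Subset n → Subset n
x ⊕ y = zipWith _xor_ x y

record FinPoset (n : ℕ) : Set₁ where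
  field
    _≼_ : Fin n → Fin n → Set
    isDecPartialOrder : IsDecPartialOrder _≡_ _≼_
  open IsDecPartialOrder isDecPartialOrder public using () renaming (_≤?_ to _≼?_)

module _ {n : ℕ} (P : FinPoset n) where
  open FinPoset P

  IsIdeal : Subset n → Set
  IsIdeal I = ∀ a b → a ∈ I → b ≼ a → b ∈ I

  ⟨_⟩ : Subset n → Subset n
  ⟨ x ⟩ = tabulate (λ b → does (any? (λ a → (a ∈? x) ×-dec (b ≼? a))))

  wP : Subset n → ℕ
  wP x = ∣ ⟨ x ⟩ ∣

  InBall : ℕ → Subset n → Set
  InBall r x = wP x ≤ r

  ErrorCorrecting : ℕ → List (Subset n) → Set
  ErrorCorrecting r C = ∀ (x c c′ b b′ : Subset n) →
    c ∈ₗ C → c′ ∈ₗ C → InBall r b → InBall r b′ →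
    x ≡ c ⊕ b → x ≡ c′ ⊕ b′ →
    (c ≡ c′) × (b ≡ b′)

-- Let U = I′ ∪ I″. If two codewords c, c′ agreed outside U, then c + c′ ⊆ U splits as
-- b + b′ with b ⊆ I′ and b′ ⊆ I″; both have P-weight ≤ r because I′, I″ are ideals, and
-- c + b = c′ + b′ forces c = c′. So the code is injective on the n - |U| coordinates
-- outside U, whence 2^(n-m) = |C| ≤ 2^(n-|U|).
module Submission where

open import Defs
open import Data.Nat using (ℕ; suc; _≤_; _∸_; _^_; _+_; z≤n; s≤s)
open import Data.Nat.Properties
  using (≤-reflexive; ≤-trans; +-suc; +-identityʳ; +-mono-≤; ≮⇒≥; <⇒≱; ^-monoʳ-<;
         ∸-cancelʳ-≤; module ≤-Reasoning)
open import Data.Bool using (Bool; true; false; _xor_; _∧_; not; _≟_)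
open import Data.Bool.Properties using (T-≡)
open import Data.Fin.Properties using (any?)
open import Data.Fin.Subset using (Subset; ∣_∣; _∪_; _∩_; ∁; _∈_; _⊆_)
open import Data.Fin.Subset.Properties
  using (_∈?_; p⊆q⇒∣p∣≤∣q∣; ∣∁p∣≡n∸∣p∣; ∣p∣≤n; p∩q⊆q; x∈p∩q⁻; x∈p∪q⁻; x∈∁p⇒x∉p;
         out⊆; s⊆s)
open import Data.Vec using (Vec; []; _∷_; tail; lookup)
open import Data.Vec.Properties using ([]=⇒lookup; lookup∘tabulate)
open import Data.List using (List; []; _∷_; length; map)
open import Data.List.Properties using (length-map)
open import Data.List.Relation.Unary.All as All using (All; []; _∷_)
open import Data.List.Relation.Unary.AllPairs as AllPairs using (AllPairs; []; _∷_)
open import Data.List.Relation.Unary.AllPairs.Properties using (map⁺)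
open import Data.List.Relation.Unary.Any using (here; there)
open import Data.List.Relation.Unary.Unique.Propositional using (Unique)
open import Data.List.Membership.Propositional renaming (_∈_ to _∈ₗ_)
open import Data.Product using (_×_; _,_; proj₁; ∃-syntax)
open import Data.Sum using (_⊎_; inj₁; inj₂)
open import Data.Empty using (⊥; ⊥-elim)
open import Function using (_on_)
open import Function.Bundles using (Equivalence)
open import Relation.Nullary using (Dec; yes; no; does)
open import Relation.Nullary.Decidable using (_×-dec_; toWitness; isYes; isYes≗does)
open import Relation.Binary.PropositionalEquality
  using (_≡_; _≢_; refl; sym; trans; cong; cong₂; subst; module ≡-Reasoning)

private
  variable
    n : ℕ

DifferOn : Subset n → Vec Bool n → Vec Bool n → Set
DifferOn []          []      []      = ⊥
DifferOn (true ∷ M)  (a ∷ x) (b ∷ y) = a ≢ b ⊎ DifferOn M x y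
DifferOn (false ∷ M) (_ ∷ x) (_ ∷ y) = DifferOn M x y

differOn-tail : ∀ {M : Subset n} {x y} →
  DifferOn (false ∷ M) x y → DifferOn M (tail x) (tail y)
differOn-tail {x = _ ∷ _} {_ ∷ _} d = d

withHead : Bool → List (Vec Bool (suc n)) → List (Vec Bool n)
withHead b [] = []
withHead b ((a ∷ x) ∷ xs) with a ≟ b
... | yes _ = x ∷ withHead b xs
... | no  _ = withHead b xs

length-withHead : (xs : List (Vec Bool (suc n))) →
  length xs ≤ length (withHead true xs) + length (withHead false xs)
length-withHead [] = z≤n
length-withHead ((true  ∷ x) ∷ xs) = s≤s (length-withHead xs)
length-withHead ((false ∷ x) ∷ xs) =
  ≤-trans (s≤s (length-withHead xs))
          (≤-reflexive (sym (+-suc (length (withHead true xs)) (length (withHead false xs)))))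

withHead-differOn : ∀ {M : Subset n} b x (xs : List (Vec Bool (suc n))) →
  All (DifferOn (true ∷ M) (b ∷ x)) xs → All (DifferOn M x) (withHead b xs)
withHead-differOn b x [] [] = []
withHead-differOn b x ((a ∷ y) ∷ xs) (d ∷ ds) with a ≟ b
withHead-differOn b x ((.b ∷ y) ∷ xs) (inj₁ b≢b ∷ ds) | yes refl = ⊥-elim (b≢b refl)
withHead-differOn b x ((.b ∷ y) ∷ xs) (inj₂ d ∷ ds)   | yes refl = d ∷ withHead-differOn b x xs ds
... | no _ = withHead-differOn b x xs ds

withHead-allPairs : ∀ {M : Subset n} b (xs : List (Vec Bool (suc n))) →
  AllPairs (DifferOn (true ∷ M)) xs → AllPairs (DifferOn M) (withHead b xs)
withHead-allPairs b [] [] = []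
withHead-allPairs b ((a ∷ x) ∷ xs) (ds ∷ dss) with a ≟ b
... | yes refl = withHead-differOn a x xs ds ∷ withHead-allPairs b xs dss
... | no  _    = withHead-allPairs b xs dss

allPairs-differOn⇒length≤2^∣M∣ : (M : Subset n) (xs : List (Vec Bool n)) →
  AllPairs (DifferOn M) xs → length xs ≤ 2 ^ ∣ M ∣
allPairs-differOn⇒length≤2^∣M∣ [] []             _                 = z≤n
allPairs-differOn⇒length≤2^∣M∣ [] (_ ∷ [])       _                 = s≤s z≤n
allPairs-differOn⇒length≤2^∣M∣ [] ([] ∷ [] ∷ _)  ((() ∷ _) ∷ _)
allPairs-differOn⇒length≤2^∣M∣ (false ∷ M) xs ds =
  subst (_≤ 2 ^ ∣ M ∣) (length-map tail xs)
    (allPairs-differOn⇒length≤2^∣M∣ M (map tail xs) (map⁺ tails-differ))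
  where
  tails-differ : AllPairs (DifferOn M on tail) xs
  tails-differ = AllPairs.map (λ {x} {y} → differOn-tail {M = M} {x} {y}) ds
allPairs-differOn⇒length≤2^∣M∣ (true ∷ M) xs ds = begin
  length xs
    ≤⟨ length-withHead xs ⟩
  length (withHead true xs) + length (withHead false xs)
    ≤⟨ +-mono-≤ (bound true) (bound false) ⟩
  2 ^ ∣ M ∣ + 2 ^ ∣ M ∣
    ≡⟨ cong (2 ^ ∣ M ∣ +_) (+-identityʳ (2 ^ ∣ M ∣)) ⟨
  2 ^ suc ∣ M ∣
    ∎
  where
  open ≤-Reasoning
  bound : ∀ b → length (withHead b xs) ≤ 2 ^ ∣ M ∣
  bound b = allPairs-differOn⇒length≤2^∣M∣ M _ (withHead-allPairs b xs ds)

differOn∁-or-⊕⊆ : (U x y : Subset n) → DifferOn (∁ U) x y ⊎ x ⊕ y ⊆ U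
differOn∁-or-⊕⊆ [] [] [] = inj₂ (λ ())
differOn∁-or-⊕⊆ (u ∷ U) (a ∷ x) (b ∷ y) with differOn∁-or-⊕⊆ U x y
differOn∁-or-⊕⊆ (true  ∷ U) (a ∷ x) (b ∷ y) | inj₁ d = inj₁ d
differOn∁-or-⊕⊆ (false ∷ U) (a ∷ x) (b ∷ y) | inj₁ d = inj₁ (inj₂ d)
differOn∁-or-⊕⊆ (u     ∷ U) (true  ∷ x) (true  ∷ y) | inj₂ ⊆U = inj₂ (out⊆ ⊆U)
differOn∁-or-⊕⊆ (u     ∷ U) (false ∷ x) (false ∷ y) | inj₂ ⊆U = inj₂ (out⊆ ⊆U)
differOn∁-or-⊕⊆ (true  ∷ U) (true  ∷ x) (false ∷ y) | inj₂ ⊆U = inj₂ (s⊆s ⊆U)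
differOn∁-or-⊕⊆ (true  ∷ U) (false ∷ x) (true  ∷ y) | inj₂ ⊆U = inj₂ (s⊆s ⊆U)
differOn∁-or-⊕⊆ (false ∷ U) (true  ∷ x) (false ∷ y) | inj₂ _  = inj₁ (inj₁ (λ ()))
differOn∁-or-⊕⊆ (false ∷ U) (false ∷ x) (true  ∷ y) | inj₂ _  = inj₁ (inj₁ (λ ()))

⊕-split : (A x y : Subset n) → x ⊕ ((x ⊕ y) ∩ A) ≡ y ⊕ ((x ⊕ y) ∩ ∁ A)
⊕-split [] [] [] = refl
⊕-split (p ∷ A) (a ∷ x) (b ∷ y) = cong₂ _∷_ (xor-split a b p) (⊕-split A x y)
  where
  xor-split : ∀ a b p → a xor ((a xor b) ∧ p) ≡ b xor ((a xor b) ∧ not p)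
  xor-split true  true  p     = refl
  xor-split false false p     = refl
  xor-split true  false true  = refl
  xor-split true  false false = refl
  xor-split false true  true  = refl
  xor-split false true  false = refl

p⊆q∪r⇒p∩∁q⊆r : {p q r : Subset n} → p ⊆ q ∪ r → p ∩ ∁ q ⊆ r
p⊆q∪r⇒p∩∁q⊆r {p = p} {q} {r} p⊆q∪r i∈p∩∁q with x∈p∩q⁻ p (∁ q) i∈p∩∁q
... | i∈p , i∈∁q with x∈p∪q⁻ q r (p⊆q∪r i∈p)
...   | inj₁ i∈q = ⊥-elim (x∈∁p⇒x∉p i∈∁q i∈q)
...   | inj₂ i∈r = i∈r

module _ (P : FinPoset n) where
  open FinPoset P

  ∈⟨⟩⁻ : ∀ {x b} → b ∈ ⟨_⟩ P x → ∃[ a ] a ∈ x × b ≼ a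
  ∈⟨⟩⁻ {x} {b} b∈⟨x⟩ = toWitness {a? = some-above} (Equivalence.from T-≡ isYes≡true)
    where
    some-above : Dec (∃[ a ] a ∈ x × b ≼ a)
    some-above = any? (λ a → (a ∈? x) ×-dec (b ≼? a))
    isYes≡true : isYes some-above ≡ true
    isYes≡true = begin
      isYes some-above       ≡⟨ isYes≗does some-above ⟩
      does some-above        ≡⟨ lookup∘tabulate _ b ⟨
      lookup (⟨_⟩ P x) b     ≡⟨ []=⇒lookup b∈⟨x⟩ ⟩
      true                   ∎
      where open ≡-Reasoning

  ⟨⟩-least : ∀ {I x} → IsIdeal P I → x ⊆ I → ⟨_⟩ P x ⊆ I
  ⟨⟩-least I-ideal x⊆I b∈⟨x⟩ with ∈⟨⟩⁻ b∈⟨x⟩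
  ... | a , a∈x , b≼a = I-ideal _ _ (x⊆I a∈x) b≼a

  wP≤∣ideal∣ : ∀ {I x} → IsIdeal P I → x ⊆ I → wP P x ≤ ∣ I ∣
  wP≤∣ideal∣ I-ideal x⊆I = p⊆q⇒∣p∣≤∣q∣ (⟨⟩-least I-ideal x⊆I)

  codewords-differOn-∁∪ : ∀ {r C I′ I″} → ErrorCorrecting P r C →
    IsIdeal P I′ → ∣ I′ ∣ ≤ r → IsIdeal P I″ → ∣ I″ ∣ ≤ r →
    ∀ {c c′} → c ∈ₗ C → c′ ∈ₗ C → c ≢ c′ → DifferOn (∁ (I′ ∪ I″)) c c′
  codewords-differOn-∁∪ {I′ = I′} {I″} C-correcting I′-ideal ∣I′∣≤r I″-ideal ∣I″∣≤r
                        {c} {c′} c∈C c′∈C c≢c′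
    with differOn∁-or-⊕⊆ (I′ ∪ I″) c c′
  ... | inj₁ d = d
  ... | inj₂ c⊕c′⊆I′∪I″ =
    ⊥-elim (c≢c′ (proj₁ (C-correcting _ c c′ _ _ c∈C c′∈C
      (≤-trans (wP≤∣ideal∣ I′-ideal (p∩q⊆q (c ⊕ c′) I′)) ∣I′∣≤r)
      (≤-trans (wP≤∣ideal∣ I″-ideal (p⊆q∪r⇒p∩∁q⊆r c⊕c′⊆I′∪I″)) ∣I″∣≤r)
      refl (⊕-split I′ c c′))))

unique⇒allPairs : ∀ {A : Set} {R : A → A → Set} {xs : List A} → Unique xs →
  (∀ {x y} → x ∈ₗ xs → y ∈ₗ xs → x ≢ y → R x y) → AllPairs R xs
unique⇒allPairs [] _ = []
unique⇒allPairs (x≢xs ∷ xs!) R-distinct =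
  All.tabulate (λ y∈xs → R-distinct (here refl) (there y∈xs) (All.lookup x≢xs y∈xs))
  ∷ unique⇒allPairs xs! (λ x∈xs y∈xs → R-distinct (there x∈xs) (there y∈xs))

2^m≤2^n⇒m≤n : ∀ {m n} → 2 ^ m ≤ 2 ^ n → m ≤ n
2^m≤2^n⇒m≤n 2^m≤2^n = ≮⇒≥ (λ n<m → <⇒≱ (^-monoʳ-< 2 (s≤s (s≤s z≤n)) n<m) 2^m≤2^n)

lemma2 : (n : ℕ) (P : FinPoset n) (r m : ℕ) → r ≤ n → m ≤ n →
    (C : List (Subset n)) → Unique C → length C ≡ 2 ^ (n ∸ m) →
    ErrorCorrecting P r C →
    (I′ I″ : Subset n) → IsIdeal P I′ → ∣ I′ ∣ ≡ r → IsIdeal P I″ → ∣ I″ ∣ ≡ r →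
    ∣ I′ ∪ I″ ∣ ≤ m
lemma2 n P r m _ _ C C! ∣C∣≡2^[n∸m] C-correcting I′ I″ I′-ideal ∣I′∣≡r I″-ideal ∣I″∣≡r =
  ∸-cancelʳ-≤ (∣p∣≤n U) (2^m≤2^n⇒m≤n (begin
    2 ^ (n ∸ m)      ≡⟨ ∣C∣≡2^[n∸m] ⟨
    length C         ≤⟨ allPairs-differOn⇒length≤2^∣M∣ (∁ U) C differ ⟩
    2 ^ ∣ ∁ U ∣      ≡⟨ cong (2 ^_) (∣∁p∣≡n∸∣p∣ U) ⟩
    2 ^ (n ∸ ∣ U ∣)  ∎))
  where
  open ≤-Reasoning
  U : Subset n
  U = I′ ∪ I″
  differ : AllPairs (DifferOn (∁ U)) C
  differ = unique⇒allPairs C! (codewords-differOn-∁∪ P C-correcting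
    I′-ideal (≤-reflexive ∣I′∣≡r) I″-ideal (≤-reflexive ∣I″∣≡r))
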